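{- Let $\mathbb{I}$ be a consistent interval. If for every $j:\mathbb{I}$ the comparison map $\sigma_{[\![j]\!]}\colon[\![j]\!]_\bot\to L([\![j]\!])$ is an equivalence, then the map $\mathbf 2\to\mathbb{I}$ sending the two elements of the booleans to $0$ and $1$ is an equivalence.
   Context: Homotopy type theory. An interval is a set $\mathbb{I}$ with bounded meet-semilattice structure $(0,1,\sqcap)$, $i\sqsubseteq j$ meaning $i\sqcap j=i$; $[\![i]\!]:\equiv(i=1)$; consistent means $0\ne1$. The join $P*X$ is the pushout of $P\leftarrow P\times X\to X$; the Sierpiński cone of $X$ is $X_\bot:\equiv\sum_{i:\mathbb{I}}(i=0)*X$ (so $[\![j]\!]_\bot\simeq\sum_{i:\mathbb{I}}(i=0\lor j=1)$). $L(X):\equiv\sum_{i:\mathbb{I}}X^{[\![i]\!]}$. The comparison map $\sigma_X\colon X_\bot\to L(X)$ is the map over $\mathbb{I}$ given on the fibre over $i$ by the map $(i=0)*X\to X^{[\![i]\!]}$ induced by $x\mapsto\lambda\_.x$ and the unique map $(i=0)\to X^{[\![i]\!]}$. -}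

{-# OPTIONS --without-K #-}
module Defs where

open import Level using (Level; _⊔_)
open import Data.Bool using (Bool; true; false)
open import Data.Empty using (⊥; ⊥-elim)
open import Data.Product using (Σ; _×_; _,_; proj₁; proj₂)
open import Relation.Nullary using (¬_)
open import Relation.Binary.PropositionalEquality using (_≡_; refl; sym; trans; subst)
open import Axiom.Extensionality.Propositional using (Extensionality)

isContr : ∀ {a} → Set a → Set a
isContr A = Σ A (λ c → ∀ x → c ≡ x)

isProp : ∀ {a} → Set a → Set a
isProp A = (x y : A) → x ≡ y

isSet : ∀ {a} → Set a → Set a
isSet A = (x y : A) → isProp (x ≡ y)

fiber : ∀ {a b} {A : Set a} {B : Set b} → (A → B) → B → Set (a ⊔ b)
fiber {A = A} f y = Σ A (λ x → f x ≡ y)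

isEquiv : ∀ {a b} {A : Set a} {B : Set b} → (A → B) → Set (a ⊔ b)
isEquiv f = ∀ y → isContr (fiber f y)

_≃_ : ∀ {a b} → Set a → Set b → Set (a ⊔ b)
A ≃ B = Σ (A → B) isEquiv

idtoeqv : ∀ {a} {A B : Set a} → A ≡ B → A ≃ B
idtoeqv refl = (λ x → x) , λ y → (y , refl) , λ { (x , refl) → refl }

Univalence : (a : Level) → Set (Level.suc a)
Univalence a = (A B : Set a) → isEquiv (idtoeqv {A = A} {B = B})

apd : ∀ {a b} {A : Set a} {B : A → Set b} (f : (x : A) → B x) {x y : A}
      (e : x ≡ y) → subst B e (f x) ≡ f y
apd f refl = refl

record Interval (ℓ : Level) : Set (Level.suc ℓ) where
  field
    𝕀       : Set ℓ
    𝕀-isSet : isSet 𝕀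
    𝟘 𝟙     : 𝕀
    _⊓_     : 𝕀 → 𝕀 → 𝕀
    ⊓-assoc : ∀ i j k → (i ⊓ j) ⊓ k ≡ i ⊓ (j ⊓ k)
    ⊓-comm  : ∀ i j → i ⊓ j ≡ j ⊓ i
    ⊓-idem  : ∀ i → i ⊓ i ≡ i
    ⊓-𝟙     : ∀ i → i ⊓ 𝟙 ≡ i
    ⊓-𝟘     : ∀ i → i ⊓ 𝟘 ≡ 𝟘

  _⊑_ : 𝕀 → 𝕀 → Set ℓ
  i ⊑ j = i ⊓ j ≡ i

  ⟦_⟧ : 𝕀 → Set ℓ
  ⟦ i ⟧ = i ≡ 𝟙

  Consistent : Set ℓ
  Consistent = ¬ (𝟘 ≡ 𝟙)

-- Joins P * X, as pushouts of P ← P × X → X, given by a type with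
-- point and path constructors satisfying the (dependent) universal
-- property / induction principle of the pushout.

record JoinStr {ℓ : Level} (P X : Set ℓ) : Set (Level.suc ℓ) where
  field
    Carrier : Set ℓ
    inl     : P → Carrier
    inr     : X → Carrier
    glue    : (p : P) (x : X) → inl p ≡ inr x

  DCocone : (C : Carrier → Set ℓ) → Set ℓ
  DCocone C = Σ ((p : P) → C (inl p)) λ f →
              Σ ((x : X) → C (inr x)) λ g →
              (p : P) (x : X) → subst C (glue p x) (f p) ≡ g x

  toDCocone : (C : Carrier → Set ℓ) → ((w : Carrier) → C w) → DCocone C
  toDCocone C s = (λ p → s (inl p)) , (λ x → s (inr x)) , λ p x → apd s (glue p x)

  field
    -- induction principle (with propositional computation rules)
    induction : (C : Carrier → Set ℓ) → isEquiv (toDCocone C)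

  ind : (C : Carrier → Set ℓ) → DCocone C → (w : Carrier) → C w
  ind C c = proj₁ (proj₁ (induction C c))

HasJoins : (ℓ : Level) → Set (Level.suc ℓ)
HasJoins ℓ = (P X : Set ℓ) → JoinStr P X

module _ {ℓ : Level} (joins : HasJoins ℓ) (I : Interval ℓ) where
  open Interval I

  _*_ : Set ℓ → Set ℓ → Set ℓ
  P * X = JoinStr.Carrier (joins P X)

  -- X_⊥ :≡ Σ (i : 𝕀), (i = 0) * X
  Cone : Set ℓ → Set ℓ
  Cone X = Σ 𝕀 (λ i → (i ≡ 𝟘) * X)

  L : Set ℓ → Set ℓ
  L X = Σ 𝕀 (λ i → ⟦ i ⟧ → X)

  -- the comparison map, defined for a consistent interval (where the map
  -- (i = 0) → X^⟦i⟧ is the unique one, since ⟦ i ⟧ is then empty)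
  module _ (fe : Extensionality ℓ ℓ) (cons : Consistent) where

    private
      absurd : ∀ {i} {A : Set ℓ} → i ≡ 𝟘 → ⟦ i ⟧ → A
      absurd p u = ⊥-elim (cons (trans (sym p) u))

    σ-fibre : (X : Set ℓ) (i : 𝕀) → (i ≡ 𝟘) * X → (⟦ i ⟧ → X)
    σ-fibre X i = JoinStr.ind (joins (i ≡ 𝟘) X) (λ _ → ⟦ i ⟧ → X)
      ( (λ p → absurd p)
      , (λ x _ → x)
      , (λ p x → fe (λ u → absurd p u)) )

    σ : (X : Set ℓ) → Cone X → L X
    σ X (i , w) = i , σ-fibre X i w

bool→𝕀 : ∀ {ℓ} (I : Interval ℓ) → Bool → Interval.𝕀 I
bool→𝕀 I false = Interval.𝟘 I
bool→𝕀 I true  = Interval.𝟙 I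

{-# OPTIONS --safe #-}
{-# OPTIONS --without-K #-}
module Submission where

-- Since 𝕀 is a set and 0 ≠ 1, every fibre of 2 → 𝕀 is a proposition, so it
-- suffices to show that each j : 𝕀 is 0 or 1.  A preimage under σ of the
-- generic partial element (j , id) of L ⟦ j ⟧ lies in (j = 0) * (j = 1), and
-- a join maps into any proposition receiving both of its sides.

open import Defs
open import Axiom.Extensionality.Propositional using (Extensionality)
open import Data.Bool using (true; false)
open import Data.Empty using (⊥-elim)
open import Data.Product using (_,_; proj₁)
open import Relation.Binary.PropositionalEquality using (_≡_; sym; trans; cong; subst)

isEquiv⇒fiber : ∀ {a b} {A : Set a} {B : Set b} {f : A → B} → isEquiv f → ∀ y → fiber f y
isEquiv⇒fiber f-equiv y = proj₁ (f-equiv y)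

isProp-inhabited⇒isContr : ∀ {a} {A : Set a} → isProp A → A → isContr A
isProp-inhabited⇒isContr A-prop x = x , A-prop x

module _ {ℓ} {P X : Set ℓ} (J : JoinStr P X) where
  open JoinStr J

  join-rec-isProp : {C : Set ℓ} → isProp C → (P → C) → (X → C) → Carrier → C
  join-rec-isProp {C} C-prop f g = ind (λ _ → C) (f , g , λ _ _ → C-prop _ _)

module _ {ℓ} (I : Interval ℓ) (cons : Interval.Consistent I) where
  open Interval I

  fiber-bool→𝕀-isProp : ∀ j → isProp (fiber (bool→𝕀 I) j)
  fiber-bool→𝕀-isProp j (false , p) (false , q) = cong (false ,_) (𝕀-isSet _ _ p q)
  fiber-bool→𝕀-isProp j (true  , p) (true  , q) = cong (true ,_) (𝕀-isSet _ _ p q)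
  fiber-bool→𝕀-isProp j (false , p) (true  , q) = ⊥-elim (cons (trans p (sym q)))
  fiber-bool→𝕀-isProp j (true  , p) (false , q) = ⊥-elim (cons (trans q (sym p)))

  module _ (joins : HasJoins ℓ) where

    join-⟦⟧⇒fiber-bool→𝕀 : ∀ j → JoinStr.Carrier (joins (j ≡ 𝟘) ⟦ j ⟧) → fiber (bool→𝕀 I) j
    join-⟦⟧⇒fiber-bool→𝕀 j = join-rec-isProp (joins (j ≡ 𝟘) ⟦ j ⟧) (fiber-bool→𝕀-isProp j)
      (λ j≡𝟘 → false , sym j≡𝟘)
      (λ j≡𝟙 → true , sym j≡𝟙)

    σ-fiber⇒join : (fe : Extensionality ℓ ℓ) (X : Set ℓ) (j : 𝕀) (f : ⟦ j ⟧ → X) →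
                   fiber (σ joins I fe cons X) (j , f) → JoinStr.Carrier (joins (j ≡ 𝟘) X)
    σ-fiber⇒join fe X j f ((i , w) , σw≡jf) =
      subst (λ k → JoinStr.Carrier (joins (k ≡ 𝟘) X)) (cong proj₁ σw≡jf) w

mainTheorem19 : ∀ {ℓ} (fe : Extensionality ℓ ℓ) (ua : Univalence ℓ)
                  (joins : HasJoins ℓ) (I : Interval ℓ)
                  (cons : Interval.Consistent I) →
                  ((j : Interval.𝕀 I) → isEquiv (σ joins I fe cons (Interval.⟦_⟧ I j))) →
                  isEquiv (bool→𝕀 I)
mainTheorem19 fe _ joins I cons σ-equiv j =
  isProp-inhabited⇒isContr (fiber-bool→𝕀-isProp I cons j)
    (join-⟦⟧⇒fiber-bool→𝕀 I cons joins j
      (σ-fiber⇒join I cons joins fe ⟦ j ⟧ j (λ u → u)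
        (isEquiv⇒fiber (σ-equiv j) (j , λ u → u))))
  where open Interval I
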